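{- For every positive integer $k$, every bipartite graph admits a strongly $k$-uniform integer additive set-indexer.
   Context: All graphs are simple, finite and have no isolated vertices. $\mathbb{N}_0$ is the set of non-negative integers; set-labels are non-empty finite subsets of $\mathbb{N}_0$. For sets $A,B$, $A+B=\{a+b: a\in A, b\in B\}$. An integer additive set-indexer (IASI) of a graph $G$ is an injective function $f:V(G)\to 2^{\mathbb{N}_0}$ such that the induced function $f^+:E(G)\to 2^{\mathbb{N}_0}$, $f^+(uv)=f(u)+f(v)$, is also injective. An IASI $f$ is strong if $|f^+(uv)|=|f(u)|\,|f(v)|$ for every edge $uv$. A strong IASI $f$ is strongly $k$-uniform if $|f^+(e)|=k$ for every edge $e$. -}

module Defs where

open import Data.Nat using (ℕ; _+_; _*_; _>_)
open import Data.Fin using (Fin)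
open import Data.List using (List; []; length)
open import Data.List.Membership.Propositional using (_∈_)
open import Data.List.Relation.Unary.Unique.Propositional using (Unique)
open import Data.Product using (Σ; ∃; ∃-syntax; _×_; _,_)
open import Data.Sum using (_⊎_)
open import Data.Bool using (Bool)
open import Relation.Binary.PropositionalEquality using (_≡_; _≢_)
open import Relation.Nullary using (¬_)
open import Function.Bundles using (_⇔_)

record Graph (n : ℕ) : Set₁ where
  field
    Adj        : Fin n → Fin n → Set
    symmetric  : ∀ {u v} → Adj u v → Adj v u
    irreflexive : ∀ {u} → ¬ Adj u u
    noIsolated : ∀ u → ∃[ v ] Adj u v
open Graph public

Bipartite : ∀ {n} → Graph n → Set
Bipartite {n} G = Σ (Fin n → Bool) λ c → ∀ {u v} → Adj G u v → c u ≢ c v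

NSet : Set₁
NSet = ℕ → Set

⟦_⟧ : List ℕ → NSet
⟦ xs ⟧ x = x ∈ xs

_⊕_ : NSet → NSet → NSet
(A ⊕ B) x = ∃[ a ] ∃[ b ] (A a × B b × a + b ≡ x)

_≐_ : NSet → NSet → Set
A ≐ B = ∀ x → A x ⇔ B x

HasCard : NSet → ℕ → Set
HasCard A k = Σ (List ℕ) λ xs → Unique xs × length xs ≡ k × (⟦ xs ⟧ ≐ A)

-- Integer additive set-indexer: f injective (as sets) and f⁺(uv) = f(u) + f(v)
-- injective on edges (as sets; edges are unordered pairs).
record IASI {n} (G : Graph n) (f : Fin n → List ℕ) : Set where
  field
    nonempty  : ∀ v → f v ≢ []
    injective : ∀ u v → ⟦ f u ⟧ ≐ ⟦ f v ⟧ → u ≡ v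
    edgeInjective : ∀ u v u' v' → Adj G u v → Adj G u' v' →
      (⟦ f u ⟧ ⊕ ⟦ f v ⟧) ≐ (⟦ f u' ⟧ ⊕ ⟦ f v' ⟧) →
      (u ≡ u' × v ≡ v') ⊎ (u ≡ v' × v ≡ u')

Strong : ∀ {n} (G : Graph n) (f : Fin n → List ℕ) → Set
Strong G f = ∀ u v → Adj G u v →
  ∃[ a ] ∃[ b ] (HasCard ⟦ f u ⟧ a × HasCard ⟦ f v ⟧ b × HasCard (⟦ f u ⟧ ⊕ ⟦ f v ⟧) (a * b))

StronglyUniformIASI : ∀ {n} → ℕ → (G : Graph n) → (f : Fin n → List ℕ) → Set
StronglyUniformIASI k G f =
  IASI G f × Strong G f × (∀ u v → Adj G u v → HasCard (⟦ f u ⟧ ⊕ ⟦ f v ⟧) k)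

-- Use the bipartition colour (left = false, right = true) and m = n + 1, so every vertex index
-- is a base-m digit. A left vertex a gets {a m}, a right vertex b gets the k numbers
-- (b + 1) + j m² with j < k. An edge sum a m + (b + 1) + j m² has base-m digits b + 1, a, j, …:
-- the two lowest digits recover the edge (and the nonzero digit b + 1 separates right labels
-- from left ones), while the k sums over j are distinct, so the labelling is strongly k-uniform.
module Submission where

open import Defs
open import Data.Nat using (ℕ; suc; _+_; _*_; _<_; _>_; NonZero; s≤s; z≤n)
open import Data.Nat.Properties
  using (+-cancelˡ-≡; *-cancelʳ-≡; +-comm; *-identityˡ; *-identityʳ; 0≢1+n; suc-injective; m<n⇒m<1+n)
open import Data.Nat.DivMod using (_%_; [m+kn]%n≡m%n; m<n⇒m%n≡m)
open import Data.Nat.Tactic.RingSolver using (solve-∀)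
open import Data.Fin using (Fin; toℕ)
open import Data.Fin.Properties using (toℕ<n; toℕ-injective)
open import Data.List using (List; []; _∷_; map; upTo; length)
open import Data.List.Properties using (length-map; length-upTo)
open import Data.List.Relation.Unary.Any using (here)
open import Data.List.Relation.Unary.Any.Properties using (¬Any[])
open import Data.List.Membership.Propositional using (_∈_)
open import Data.List.Membership.Propositional.Properties using (∈-map⁺; ∈-map⁻; ∈-upTo⁺)
open import Data.List.Relation.Unary.All using ([])
open import Data.List.Relation.Unary.Unique.Propositional using (Unique; []; _∷_)
open import Data.List.Relation.Unary.Unique.Propositional.Properties using (map⁺; upTo⁺)
open import Data.Product using (Σ; ∃-syntax; _×_; _,_; proj₁)
open import Data.Product.Properties using (×-≡,≡→≡)
open import Data.Sum using (_⊎_; inj₁; inj₂)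
open import Data.Bool using (Bool; true; false)
open import Data.Empty using (⊥-elim)
open import Relation.Binary.PropositionalEquality using (_≡_; _≢_; refl; sym; trans; cong; subst; module ≡-Reasoning)
open import Function.Bundles using (mk⇔; Equivalence)
open import Function.Construct.Identity using (⇔-id)
open import Function.Construct.Symmetry using (⇔-sym)
open import Function.Construct.Composition using (_⇔-∘_)

≐-refl : ∀ {A} → A ≐ A
≐-refl x = ⇔-id _

≐-sym : ∀ {A B} → A ≐ B → B ≐ A
≐-sym A≐B x = ⇔-sym (A≐B x)

≐-trans : ∀ {A B C} → A ≐ B → B ≐ C → A ≐ C
≐-trans A≐B B≐C x = B≐C x ⇔-∘ A≐B x

⊕-comm : ∀ A B → (A ⊕ B) ≐ (B ⊕ A)
⊕-comm A B x = mk⇔ swap swap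
  where
  swap : ∀ {A B} → (A ⊕ B) x → (B ⊕ A) x
  swap (a , b , a∈A , b∈B , a+b≡x) = b , a , b∈B , a∈A , trans (+-comm b a) a+b≡x

singleton-⊕ : ∀ x ys → (⟦ x ∷ [] ⟧ ⊕ ⟦ ys ⟧) ≐ ⟦ map (x +_) ys ⟧
singleton-⊕ x ys z = mk⇔ to from
  where
  to : (⟦ x ∷ [] ⟧ ⊕ ⟦ ys ⟧) z → z ∈ map (x +_) ys
  to (_ , _ , here refl , y∈ys , refl) = ∈-map⁺ (x +_) y∈ys
  from : z ∈ map (x +_) ys → (⟦ x ∷ [] ⟧ ⊕ ⟦ ys ⟧) z
  from z∈ with ∈-map⁻ (x +_) z∈
  ... | y , y∈ys , refl = x , y , here refl , y∈ys , refl

HasCard-resp-≐ : ∀ {A B k} → A ≐ B → HasCard A k → HasCard B k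
HasCard-resp-≐ A≐B (xs , unique , length≡ , xs≐A) = xs , unique , length≡ , ≐-trans xs≐A A≐B

unique⇒HasCard : ∀ {xs k} → Unique xs → length xs ≡ k → HasCard ⟦ xs ⟧ k
unique⇒HasCard {xs} unique length≡ = xs , unique , length≡ , ≐-refl

+-*-digits-injective : ∀ {m r r′} q q′ .{{_ : NonZero m}} → r < m → r′ < m →
  r + q * m ≡ r′ + q′ * m → r ≡ r′ × q ≡ q′
+-*-digits-injective {m} {r} {r′} q q′ r<m r′<m eq = r≡r′ , q≡q′
  where
  r≡r′ : r ≡ r′
  r≡r′ = begin
    r                 ≡⟨ m<n⇒m%n≡m r<m ⟨
    r % m             ≡⟨ [m+kn]%n≡m%n r q m ⟨
    (r + q * m) % m   ≡⟨ cong (_% m) eq ⟩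
    (r′ + q′ * m) % m ≡⟨ [m+kn]%n≡m%n r′ q′ m ⟩
    r′ % m            ≡⟨ m<n⇒m%n≡m r′<m ⟩
    r′                ∎
    where open ≡-Reasoning
  q≡q′ : q ≡ q′
  q≡q′ = *-cancelʳ-≡ q q′ m (+-cancelˡ-≡ r _ _ (trans eq (cong (_+ q′ * m) (sym r≡r′))))

oriented : ∀ {A : Set} → Bool → A → A → A × A
oriented false a b = a , b
oriented true  a b = b , a

oriented-injective : ∀ {A : Set} x x′ {a b a′ b′ : A} → oriented x a b ≡ oriented x′ a′ b′ →
  (a ≡ a′ × b ≡ b′) ⊎ (a ≡ b′ × b ≡ a′)
oriented-injective false false refl = inj₁ (refl , refl)
oriented-injective false true  refl = inj₂ (refl , refl)
oriented-injective true  false refl = inj₂ (refl , refl)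
oriented-injective true  true  refl = inj₁ (refl , refl)

module Labelling (n k : ℕ) (k>0 : k > 0) where

  m : ℕ
  m = suc n

  rightElem : Fin n → ℕ → ℕ
  rightElem b j = suc (toℕ b) + j * m * m

  label : Bool → Fin n → List ℕ
  label false a = toℕ a * m ∷ []
  label true  b = map (rightElem b) (upTo k)

  size : Bool → ℕ
  size false = 1
  size true  = k

  edgeSum : Fin n × Fin n → NSet
  edgeSum (a , b) = ⟦ label false a ⟧ ⊕ ⟦ label true b ⟧

  toℕ<m : ∀ (a : Fin n) → toℕ a < m
  toℕ<m a = m<n⇒m<1+n (toℕ<n a)

  suc-toℕ<m : ∀ (b : Fin n) → suc (toℕ b) < m
  suc-toℕ<m b = s≤s (toℕ<n b)

  rightElem-injective : ∀ b {i j} → rightElem b i ≡ rightElem b j → i ≡ j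
  rightElem-injective b {i} {j} eq =
    *-cancelʳ-≡ i j m (*-cancelʳ-≡ (i * m) (j * m) m (+-cancelˡ-≡ (suc (toℕ b)) _ _ eq))

  rightElem0∈label : ∀ b → rightElem b 0 ∈ label true b
  rightElem0∈label b = ∈-map⁺ (rightElem b) (∈-upTo⁺ k>0)

  ∈-label-true : ∀ {z} b → z ∈ label true b → ∃[ j ] z ≡ rightElem b j
  ∈-label-true b z∈ with ∈-map⁻ (rightElem b) z∈
  ... | j , _ , z≡ = j , z≡

  label-nonempty : ∀ x a → label x a ≢ []
  label-nonempty false a ()
  label-nonempty true  b eq = ¬Any[] (subst (rightElem b 0 ∈_) eq (rightElem0∈label b))

  label-unique : ∀ x a → Unique (label x a)
  label-unique false a = [] ∷ []
  label-unique true  b = map⁺ (rightElem-injective b) (upTo⁺ k)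

  length-label : ∀ x a → length (label x a) ≡ size x
  length-label false a = refl
  length-label true  b = trans (length-map (rightElem b) (upTo k)) (length-upTo k)

  label-HasCard : ∀ x a → HasCard ⟦ label x a ⟧ (size x)
  label-HasCard x a = unique⇒HasCard (label-unique x a) (length-label x a)

  label-injective : ∀ x y a b → ⟦ label x a ⟧ ≐ ⟦ label y b ⟧ → a ≡ b
  label-injective false false a b a≐b with Equivalence.to (a≐b _) (here refl)
  ... | here am≡bm = toℕ-injective (*-cancelʳ-≡ (toℕ a) (toℕ b) m am≡bm)
  label-injective false true a b a≐b with ∈-label-true b (Equivalence.to (a≐b _) (here refl))
  ... | j , am≡ =
    ⊥-elim (0≢1+n (proj₁ (+-*-digits-injective (toℕ a) (j * m) (s≤s z≤n) (suc-toℕ<m b) am≡)))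
  label-injective true false a b a≐b = sym (label-injective false true b a (≐-sym a≐b))
  label-injective true true a b a≐b with ∈-label-true b (Equivalence.to (a≐b _) (rightElem0∈label a))
  ... | j , eq =
    toℕ-injective (suc-injective (proj₁ (+-*-digits-injective (0 * m) (j * m) (suc-toℕ<m a) (suc-toℕ<m b) eq)))

  edgeNumber : Fin n → Fin n → ℕ → ℕ
  edgeNumber a b j = suc (toℕ b) + (toℕ a + j * m) * m

  edgeNumber-injective : ∀ {a b a′ b′} j j′ → edgeNumber a b j ≡ edgeNumber a′ b′ j′ → (a , b) ≡ (a′ , b′)
  edgeNumber-injective {a} {b} {a′} {b′} j j′ eq
    with +-*-digits-injective (toℕ a + j * m) (toℕ a′ + j′ * m) (suc-toℕ<m b) (suc-toℕ<m b′) eq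
  ... | sb≡sb′ , high≡ = ×-≡,≡→≡ (toℕ-injective (proj₁ (+-*-digits-injective j j′ (toℕ<m a) (toℕ<m a′) high≡)) ,
                                   toℕ-injective (suc-injective sb≡sb′))

  ∈-edgeSum : ∀ {z} a b → edgeSum (a , b) z → ∃[ j ] z ≡ edgeNumber a b j
  ∈-edgeSum a b (_ , y , here refl , y∈ , refl) with ∈-label-true b y∈
  ... | j , refl = j , shift (toℕ a) (toℕ b) j m
    where
    shift : ∀ a b j m → a * m + (suc b + j * m * m) ≡ suc b + (a + j * m) * m
    shift = solve-∀

  edgeSum-witness : ∀ a b → edgeSum (a , b) (toℕ a * m + rightElem b 0)
  edgeSum-witness a b = _ , _ , here refl , rightElem0∈label b , refl

  edgeSum-injective : ∀ {a b a′ b′} → edgeSum (a , b) ≐ edgeSum (a′ , b′) → (a , b) ≡ (a′ , b′)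
  edgeSum-injective {a} {b} {a′} {b′} sums≐
    with ∈-edgeSum a b (edgeSum-witness a b) | ∈-edgeSum a′ b′ (Equivalence.to (sums≐ _) (edgeSum-witness a b))
  ... | j , w≡ | j′ , w≡′ = edgeNumber-injective j j′ (trans (sym w≡) w≡′)

  edgeSum-HasCard : ∀ p → HasCard (edgeSum p) k
  edgeSum-HasCard (a , b) =
    HasCard-resp-≐ (≐-sym (singleton-⊕ (toℕ a * m) (label true b)))
      (unique⇒HasCard (map⁺ (+-cancelˡ-≡ (toℕ a * m) _ _) (label-unique true b))
        (trans (length-map _ (label true b)) (length-label true b)))

  ⊕-oriented : ∀ {x y} → x ≢ y → ∀ a b → (⟦ label x a ⟧ ⊕ ⟦ label y b ⟧) ≐ edgeSum (oriented x a b)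
  ⊕-oriented {false} {false} x≢y = ⊥-elim (x≢y refl)
  ⊕-oriented {false} {true}  _ a b = ≐-refl
  ⊕-oriented {true}  {false} _ a b = ⊕-comm _ _
  ⊕-oriented {true}  {true}  x≢y = ⊥-elim (x≢y refl)

  size-opposite : ∀ {x y} → x ≢ y → size x * size y ≡ k
  size-opposite {false} {false} x≢y = ⊥-elim (x≢y refl)
  size-opposite {false} {true}  _ = *-identityˡ k
  size-opposite {true}  {false} _ = *-identityʳ k
  size-opposite {true}  {true}  x≢y = ⊥-elim (x≢y refl)

  label-⊕-HasCard : ∀ {x y} → x ≢ y → ∀ a b → HasCard (⟦ label x a ⟧ ⊕ ⟦ label y b ⟧) k
  label-⊕-HasCard {x} x≢y a b = HasCard-resp-≐ (≐-sym (⊕-oriented x≢y a b)) (edgeSum-HasCard (oriented x a b))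

  label-⊕-injective : ∀ {x y x′ y′} → x ≢ y → x′ ≢ y′ → ∀ a b a′ b′ →
    (⟦ label x a ⟧ ⊕ ⟦ label y b ⟧) ≐ (⟦ label x′ a′ ⟧ ⊕ ⟦ label y′ b′ ⟧) →
    (a ≡ a′ × b ≡ b′) ⊎ (a ≡ b′ × b ≡ a′)
  label-⊕-injective {x} {_} {x′} x≢y x′≢y′ a b a′ b′ sums≐ =
    oriented-injective x x′ (edgeSum-injective
      (≐-trans (≐-sym (⊕-oriented x≢y a b)) (≐-trans sums≐ (⊕-oriented x′≢y′ a′ b′))))

theorem4 : (k : ℕ) → k > 0 → (n : ℕ) → (G : Graph n) → Bipartite G →
    Σ (Fin n → List ℕ) (λ f → StronglyUniformIASI k G f)
theorem4 k k>0 n G (c , proper) = f , iasi , strong , uniform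
  where
  open Labelling n k k>0

  f : Fin n → List ℕ
  f v = label (c v) v

  uniform : ∀ u v → Adj G u v → HasCard (⟦ f u ⟧ ⊕ ⟦ f v ⟧) k
  uniform u v uv = label-⊕-HasCard (proper uv) u v

  iasi : IASI G f
  iasi = record
    { nonempty      = λ v → label-nonempty (c v) v
    ; injective     = λ u v → label-injective (c u) (c v) u v
    ; edgeInjective = λ u v u′ v′ uv u′v′ → label-⊕-injective (proper uv) (proper u′v′) u v u′ v′
    }

  strong : Strong G f
  strong u v uv = size (c u) , size (c v) , label-HasCard (c u) u , label-HasCard (c v) v ,
    subst (HasCard (⟦ f u ⟧ ⊕ ⟦ f v ⟧)) (sym (size-opposite (proper uv))) (uniform u v uv)
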